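{- There is a constant $c$ such that for every $n\ge1$ the boolean sum-of-squares proof system has a refutation of the binary value principle $\mathrm{BVP}_n$ (the equation $\sum_{i=1}^n2^{i-1}x_i+1=0$) of monomial size at most $cn$.
   Context: Boolean sum-of-squares (SoS) refutation of equations $\{f_i=0\}_{i\in I}$ and inequalities $\{h_j\ge0\}_{j\in J}$ over $\mathbb{R}[x_1,\dots,x_n]$, where the equations include $x_i^2-x_i=0$ and the inequalities include $x_i\ge0$ and $1-x_i\ge0$ for every $i$: polynomials $p_i$ ($i\in I$) and $s_{k,j}$ such that $\sum_{i\in I}p_if_i+\sum_{j\in J}h_j\cdot\big(\sum_k s_{k,j}^2\big)=-1$ as a formal identity. Its monomial size is $\sum_{i\in I}(\text{number of monomials of }p_i)+\sum_{j\in J}(\text{number of monomials of }\sum_ks_{k,j}^2)$. -}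

module Defs where

open import Data.Nat as ℕ using (ℕ; _^_)
open import Data.Rational as ℚ using (ℚ; 0ℚ; 1ℚ; -_)
open import Data.Fin using (Fin; toℕ)
open import Data.Fin.Properties as FinP using ()
open import Data.Vec as Vec using (Vec)
open import Data.Vec.Properties using (≡-dec)
import Data.Nat.ListAction
open import Data.List as List using (List; []; _∷_; _++_)
open import Data.Product using (_×_; _,_; proj₁; proj₂)
open import Relation.Nullary using (¬?)
open import Relation.Binary.PropositionalEquality using (_≡_)

Monomial : ℕ → Set
Monomial n = Vec ℕ n

_≟ₘ_ : ∀ {n} (a b : Monomial n) → Relation.Nullary.Dec (a ≡ b)
_≟ₘ_ = ≡-dec ℕ._≟_

-- Polynomials over ℚ in n variables, as finite (unnormalised) lists of terms.
Poly : ℕ → Set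
Poly n = List (ℚ × Monomial n)

coeff : ∀ {n} → Poly n → Monomial n → ℚ
coeff p m = List.foldr ℚ._+_ 0ℚ
  (List.map proj₁ (List.filter (λ t → proj₂ t ≟ₘ m) p))

_≈ₚ_ : ∀ {n} → Poly n → Poly n → Set
p ≈ₚ q = ∀ m → coeff p m ≡ coeff q m

support : ∀ {n} → Poly n → List (Monomial n)
support p = List.deduplicate _≟ₘ_
  (List.filter (λ m → ¬? (coeff p m ℚ.≟ 0ℚ)) (List.map proj₂ p))

monoCount : ∀ {n} → Poly n → ℕ
monoCount p = List.length (support p)

infixl 6 _+ₚ_
infixl 7 _*ₚ_ _·ₚ_

_+ₚ_ : ∀ {n} → Poly n → Poly n → Poly n
_+ₚ_ = _++_

_*ₚ_ : ∀ {n} → Poly n → Poly n → Poly n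
p *ₚ q = List.concatMap
  (λ { (a , m) → List.map (λ { (b , m′) → (a ℚ.* b , Vec.zipWith ℕ._+_ m m′) }) q }) p

_·ₚ_ : ∀ {n} → ℚ → Poly n → Poly n
c ·ₚ p = List.map (λ { (a , m) → (c ℚ.* a , m) }) p

constₚ : ∀ {n} → ℚ → Poly n
constₚ {n} c = (c , Vec.replicate n 0) ∷ []

varₚ : ∀ {n} → Fin n → Poly n
varₚ {n} i = (1ℚ , Vec.tabulate (λ j → unitAt j)) ∷ []
  where
  unitAt : Fin n → ℕ
  unitAt j with i FinP.≟ j
  ... | Relation.Nullary.yes _ = 1
  ... | Relation.Nullary.no _ = 0

Σₚ : ∀ {n} → List (Poly n) → Poly n
Σₚ = List.foldr _+ₚ_ []

ΣFin : ∀ {n k} → (Fin k → Poly n) → Poly n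
ΣFin {k = k} f = Σₚ (List.map f (List.allFin k))

ΣFinℕ : ∀ {k} → (Fin k → ℕ) → ℕ
ΣFinℕ {k} f = Data.Nat.ListAction.sum (List.map f (List.allFin k))

sumSq : ∀ {n} → List (Poly n) → Poly n
sumSq ss = Σₚ (List.map (λ s → s *ₚ s) ss)

two^ : ℕ → ℚ
two^ k = ℚ.fromℚᵘ (Data.Rational.Unnormalised.mkℚᵘ (Data.Integer.+ (2 ^ k)) 0)
  where import Data.Rational.Unnormalised; import Data.Integer

-- BVP_n :  Σ_{i=1}^n 2^{i-1} x_i + 1  (variables indexed 0..n-1, x_i has weight 2^i).
bvp : (n : ℕ) → Poly n
bvp n = ΣFin (λ i → two^ (toℕ i) ·ₚ varₚ i) +ₚ constₚ 1ℚ

boolAx : ∀ {n} → Fin n → Poly n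
boolAx i = varₚ i *ₚ varₚ i +ₚ (- 1ℚ) ·ₚ varₚ i

lowerAx : ∀ {n} → Fin n → Poly n
lowerAx i = varₚ i

upperAx : ∀ {n} → Fin n → Poly n
upperAx i = constₚ 1ℚ +ₚ (- 1ℚ) ·ₚ varₚ i

record BoolSoSRefutation (n : ℕ) : Set where
  field
    pBVP  : Poly n
    pBool : Fin n → Poly n
    sLow  : Fin n → List (Poly n)
    sUp   : Fin n → List (Poly n)
    identity :
      (pBVP *ₚ bvp n
        +ₚ ΣFin (λ i → pBool i *ₚ boolAx i)
        +ₚ ΣFin (λ i → lowerAx i *ₚ sumSq (sLow i))
        +ₚ ΣFin (λ i → upperAx i *ₚ sumSq (sUp i)))
      ≈ₚ constₚ (- 1ℚ)

  monomialSize : ℕ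
  monomialSize = monoCount pBVP
    ℕ.+ ΣFinℕ (λ i → monoCount (pBool i))
    ℕ.+ ΣFinℕ (λ i → monoCount (sumSq (sLow i)))
    ℕ.+ ΣFinℕ (λ i → monoCount (sumSq (sUp i)))

-- Writing B for Σᵢ 2^i xᵢ, the refutation is the identity
--   (−1)·(B + 1) + Σᵢ xᵢ·2^i = −1,
-- where each coefficient 2^i is a sum of 2^i squares 1², so it multiplies the
-- axiom xᵢ ≥ 0 legitimately. Every multiplier has a single monomial, so the
-- monomial size is 1 + n.
module Submission where

open import Defs
open import Data.Nat using (ℕ; _≤_; _*_)
open import Data.Product using (Σ; ∃)

open import Algebra.Bundles using (CommutativeMonoid)
import Algebra.Properties.CommutativeSemigroup as CommutativeSemigroupProperties
open import Data.Empty using (⊥-elim)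
open import Data.Fin using (Fin; toℕ)
import Data.Integer as ℤ
import Data.Integer.Properties as ℤ
open import Data.List as List using (List; []; _∷_; _++_; [_])
import Data.List.Properties as List
open import Data.List.Relation.Unary.All using (All; []; _∷_)
import Data.List.Relation.Unary.All.Properties as All
import Data.List.Relation.Unary.Unique.DecPropositional.Properties as UniqueProperties
open import Data.List.Relation.Unary.Unique.Propositional using (Unique; []; _∷_)
open import Data.Nat as ℕ using (suc; zero; z≤n; s≤s)
import Data.Nat.ListAction as ℕ
import Data.Nat.Properties as ℕ
import Data.Nat.Solver as ℕ
open import Data.Product using (_,_; proj₂)
open import Data.Rational as ℚ using (ℚ; 0ℚ; 1ℚ; -_)
import Data.Rational.Properties as ℚ
import Data.Rational.Solver as ℚ
import Data.Rational.Unnormalised as ℚᵘ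
import Data.Rational.Unnormalised.Properties as ℚᵘ
open import Data.Vec.Properties using (zipWith-identityˡ; zipWith-identityʳ)
import Data.Vec as Vec
open import Function using (id)
open import Relation.Nullary using (yes; no)
open import Relation.Binary.PropositionalEquality hiding ([_])

2^ᵘ : ℕ → ℚᵘ.ℚᵘ
2^ᵘ k = ℚᵘ.mkℚᵘ (ℤ.+ (2 ℕ.^ k)) 0

2^ᵘ-suc : ∀ k → 2^ᵘ (suc k) ℚᵘ.≃ 2^ᵘ k ℚᵘ.+ 2^ᵘ k
2^ᵘ-suc k = ℚᵘ.*≡* (cong (ℤ._* ℤ.1ℤ) (begin
  ℤ.+ (2 ℕ.^ suc k)                  ≡⟨ cong (λ x → ℤ.+ (a ℕ.+ x)) (ℕ.+-identityʳ a) ⟩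
  ℤ.+ a ℤ.+ ℤ.+ a                    ≡⟨ cong₂ ℤ._+_ (ℤ.*-identityʳ (ℤ.+ a)) (ℤ.*-identityʳ (ℤ.+ a)) ⟨
  ℤ.+ a ℤ.* ℤ.1ℤ ℤ.+ ℤ.+ a ℤ.* ℤ.1ℤ  ∎))
  where
  open ≡-Reasoning
  a : ℕ
  a = 2 ℕ.^ k

two^-suc : ∀ k → two^ (suc k) ≡ two^ k ℚ.+ two^ k
two^-suc k = ℚ.toℚᵘ-injective (begin-equality
  ℚ.toℚᵘ (two^ (suc k))                ≃⟨ ℚ.toℚᵘ-fromℚᵘ (2^ᵘ (suc k)) ⟩
  2^ᵘ (suc k)                          ≃⟨ 2^ᵘ-suc k ⟩
  2^ᵘ k ℚᵘ.+ 2^ᵘ k                     ≃⟨ ℚᵘ.+-cong (ℚ.toℚᵘ-fromℚᵘ (2^ᵘ k)) (ℚ.toℚᵘ-fromℚᵘ (2^ᵘ k)) ⟨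
  ℚ.toℚᵘ (two^ k) ℚᵘ.+ ℚ.toℚᵘ (two^ k) ≃⟨ ℚ.toℚᵘ-homo-+ (two^ k) (two^ k) ⟨
  ℚ.toℚᵘ (two^ k ℚ.+ two^ k)           ∎)
  where open ℚᵘ.≤-Reasoning

length≤1 : ∀ {A : Set} {w : A} {xs : List A} → Unique xs → All (_≡ w) xs → List.length xs ≤ 1
length≤1 []                   _                  = z≤n
length≤1 (_ ∷ [])             _                  = s≤s z≤n
length≤1 ((x≢y ∷ _) ∷ _ ∷ _) (refl ∷ refl ∷ _) = ⊥-elim (x≢y refl)

sum-map-≤ : ∀ {A : Set} (f : A → ℕ) {b} xs → (∀ x → f x ≤ b) → ℕ.sum (List.map f xs) ≤ List.length xs * b
sum-map-≤ f []       f≤b = z≤n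
sum-map-≤ f (x ∷ xs) f≤b = ℕ.+-mono-≤ (f≤b x) (sum-map-≤ f xs f≤b)

ΣFinℕ-≤ : ∀ {k b} (f : Fin k → ℕ) → (∀ i → f i ≤ b) → ΣFinℕ f ≤ k * b
ΣFinℕ-≤ {k} {b} f f≤b =
  subst (λ l → ΣFinℕ f ≤ l * b) (List.length-tabulate {n = k} id) (sum-map-≤ f (List.allFin k) f≤b)

module _ {n : ℕ} where

  0⃗ : Monomial n
  0⃗ = Vec.replicate n 0

  termCoeff : Monomial n → ℚ → Monomial n → ℚ
  termCoeff w a m with w ≟ₘ m
  ... | yes _ = a
  ... | no  _ = 0ℚ

  coeff-∷ : ∀ a w (p : Poly n) m → coeff ((a , w) ∷ p) m ≡ termCoeff w a m ℚ.+ coeff p m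
  coeff-∷ a w p m with w ≟ₘ m
  ... | yes _ = refl
  ... | no  _ = sym (ℚ.+-identityˡ (coeff p m))

  coeff-+ₚ : ∀ (p q : Poly n) m → coeff (p +ₚ q) m ≡ coeff p m ℚ.+ coeff q m
  coeff-+ₚ []            q m = sym (ℚ.+-identityˡ (coeff q m))
  coeff-+ₚ ((a , w) ∷ p) q m = begin
    coeff ((a , w) ∷ p +ₚ q) m                     ≡⟨ coeff-∷ a w (p +ₚ q) m ⟩
    termCoeff w a m ℚ.+ coeff (p +ₚ q) m           ≡⟨ cong (termCoeff w a m ℚ.+_) (coeff-+ₚ p q m) ⟩
    termCoeff w a m ℚ.+ (coeff p m ℚ.+ coeff q m)  ≡⟨ ℚ.+-assoc (termCoeff w a m) (coeff p m) (coeff q m) ⟨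
    termCoeff w a m ℚ.+ coeff p m ℚ.+ coeff q m    ≡⟨ cong (ℚ._+ coeff q m) (coeff-∷ a w p m) ⟨
    coeff ((a , w) ∷ p) m ℚ.+ coeff q m            ∎
    where open ≡-Reasoning

  coeff-+ₚ-cong : ∀ (p q : Poly n) {m x y} → coeff p m ≡ x → coeff q m ≡ y →
                  coeff (p +ₚ q) m ≡ x ℚ.+ y
  coeff-+ₚ-cong p q {m} refl refl = coeff-+ₚ p q m

  *-termCoeff : ∀ c w a m → c ℚ.* termCoeff w a m ≡ termCoeff w (c ℚ.* a) m
  *-termCoeff c w a m with w ≟ₘ m
  ... | yes _ = refl
  ... | no  _ = ℚ.*-zeroʳ c

  coeff-·ₚ : ∀ c (p : Poly n) m → coeff (c ·ₚ p) m ≡ c ℚ.* coeff p m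
  coeff-·ₚ c []            m = sym (ℚ.*-zeroʳ c)
  coeff-·ₚ c ((a , w) ∷ p) m = begin
    coeff (c ·ₚ ((a , w) ∷ p)) m                       ≡⟨ coeff-∷ (c ℚ.* a) w (c ·ₚ p) m ⟩
    termCoeff w (c ℚ.* a) m ℚ.+ coeff (c ·ₚ p) m       ≡⟨ cong₂ ℚ._+_ (sym (*-termCoeff c w a m)) (coeff-·ₚ c p m) ⟩
    c ℚ.* termCoeff w a m ℚ.+ c ℚ.* coeff p m          ≡⟨ ℚ.*-distribˡ-+ c (termCoeff w a m) (coeff p m) ⟨
    c ℚ.* (termCoeff w a m ℚ.+ coeff p m)              ≡⟨ cong (c ℚ.*_) (coeff-∷ a w p m) ⟨
    c ℚ.* coeff ((a , w) ∷ p) m                        ∎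
    where open ≡-Reasoning

  constₚ-*ₚ : ∀ c (q : Poly n) → constₚ c *ₚ q ≡ c ·ₚ q
  constₚ-*ₚ c []            = refl
  constₚ-*ₚ c ((b , w) ∷ q) =
    cong₂ _∷_ (cong (c ℚ.* b ,_) (zipWith-identityˡ ℕ.+-identityˡ w)) (constₚ-*ₚ c q)

  *ₚ-constₚ : ∀ (p : Poly n) c → p *ₚ constₚ c ≡ c ·ₚ p
  *ₚ-constₚ []            c = refl
  *ₚ-constₚ ((a , w) ∷ p) c =
    cong₂ _∷_ (cong₂ _,_ (ℚ.*-comm a c) (zipWith-identityʳ ℕ.+-identityʳ w)) (*ₚ-constₚ p c)

  *ₚ-zeroʳ : ∀ (p : Poly n) → p *ₚ [] ≡ []
  *ₚ-zeroʳ []      = refl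
  *ₚ-zeroʳ (_ ∷ p) = *ₚ-zeroʳ p

  *ₚ-distribʳ : ∀ (p p′ q : Poly n) → (p +ₚ p′) *ₚ q ≡ p *ₚ q +ₚ p′ *ₚ q
  *ₚ-distribʳ p p′ q = List.concatMap-++ _ p p′

  [-]-*ₚ-distribˡ : ∀ t (q r : Poly n) → [ t ] *ₚ (q +ₚ r) ≡ [ t ] *ₚ q +ₚ [ t ] *ₚ r
  [-]-*ₚ-distribˡ (a , w) []      r = refl
  [-]-*ₚ-distribˡ (a , w) (s ∷ q) r = cong (_ ∷_) ([-]-*ₚ-distribˡ (a , w) q r)

  coeff-*ₚ-distribˡ : ∀ (p q r : Poly n) m →
                      coeff (p *ₚ (q +ₚ r)) m ≡ coeff (p *ₚ q) m ℚ.+ coeff (p *ₚ r) m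
  coeff-*ₚ-distribˡ []      q r m = refl
  coeff-*ₚ-distribˡ (t ∷ p) q r m = begin
    coeff ((t ∷ p) *ₚ (q ++ r)) m
      ≡⟨ cong (λ s → coeff s m)
           (trans (*ₚ-distribʳ [ t ] p (q ++ r)) (cong (_++ p *ₚ (q ++ r)) ([-]-*ₚ-distribˡ t q r))) ⟩
    coeff ([ t ] *ₚ q +ₚ [ t ] *ₚ r +ₚ p *ₚ (q ++ r)) m
      ≡⟨ coeff-+ₚ-cong ([ t ] *ₚ q +ₚ [ t ] *ₚ r) (p *ₚ (q ++ r))
           (coeff-+ₚ ([ t ] *ₚ q) ([ t ] *ₚ r) m) (coeff-*ₚ-distribˡ p q r m) ⟩
    (tq ℚ.+ tr) ℚ.+ (coeff (p *ₚ q) m ℚ.+ coeff (p *ₚ r) m)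
      ≡⟨ interchange tq tr (coeff (p *ₚ q) m) (coeff (p *ₚ r) m) ⟩
    (tq ℚ.+ coeff (p *ₚ q) m) ℚ.+ (tr ℚ.+ coeff (p *ₚ r) m)
      ≡⟨ cong₂ ℚ._+_ (coeff-+ₚ ([ t ] *ₚ q) (p *ₚ q) m) (coeff-+ₚ ([ t ] *ₚ r) (p *ₚ r) m) ⟨
    coeff ([ t ] *ₚ q +ₚ p *ₚ q) m ℚ.+ coeff ([ t ] *ₚ r +ₚ p *ₚ r) m
      ≡⟨ cong₂ (λ s s′ → coeff s m ℚ.+ coeff s′ m) (*ₚ-distribʳ [ t ] p q) (*ₚ-distribʳ [ t ] p r) ⟨
    coeff ((t ∷ p) *ₚ q) m ℚ.+ coeff ((t ∷ p) *ₚ r) m ∎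
    where
    open ≡-Reasoning
    open CommutativeSemigroupProperties (CommutativeMonoid.commutativeSemigroup ℚ.+-0-commutativeMonoid)
    tq tr : ℚ
    tq = coeff ([ t ] *ₚ q) m
    tr = coeff ([ t ] *ₚ r) m

  coeff-Σₚ-cong : ∀ {A : Set} (f g : A → Poly n) xs m → (∀ x → coeff (f x) m ≡ coeff (g x) m) →
                  coeff (Σₚ (List.map f xs)) m ≡ coeff (Σₚ (List.map g xs)) m
  coeff-Σₚ-cong f g []       m f≗g = refl
  coeff-Σₚ-cong f g (x ∷ xs) m f≗g =
    trans (coeff-+ₚ-cong (f x) _ (f≗g x) (coeff-Σₚ-cong f g xs m f≗g)) (sym (coeff-+ₚ (g x) _ m))

  coeff-Σₚ-zero : ∀ {A : Set} (f : A → Poly n) xs m → (∀ x → coeff (f x) m ≡ 0ℚ) →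
                  coeff (Σₚ (List.map f xs)) m ≡ 0ℚ
  coeff-Σₚ-zero f []       m f≗0 = refl
  coeff-Σₚ-zero f (x ∷ xs) m f≗0 = coeff-+ₚ-cong (f x) _ (f≗0 x) (coeff-Σₚ-zero f xs m f≗0)

  sumSq-++ : ∀ (xs ys : List (Poly n)) → sumSq (xs ++ ys) ≡ sumSq xs +ₚ sumSq ys
  sumSq-++ xs ys =
    trans (cong List.concat (List.map-++ sq xs ys)) (sym (List.concat-++ (List.map sq xs) (List.map sq ys)))
    where
    sq : Poly n → Poly n
    sq s = s *ₚ s

  -- 2^k copies of the constant 1, whose squares sum to 2^k
  -- (a single rational square does not suffice for odd k).
  ones : ℕ → List (Poly n)
  ones zero    = [ constₚ 1ℚ ]
  ones (suc k) = ones k ++ ones k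

  coeff-*ₚ-sumSq-ones : ∀ k (p : Poly n) m → coeff (p *ₚ sumSq (ones k)) m ≡ two^ k ℚ.* coeff p m
  coeff-*ₚ-sumSq-ones zero p m = begin
    coeff (p *ₚ (constₚ 1ℚ *ₚ constₚ 1ℚ)) m ≡⟨ cong (λ s → coeff (p *ₚ s) m) (constₚ-*ₚ 1ℚ (constₚ 1ℚ)) ⟩
    coeff (p *ₚ constₚ 1ℚ) m                ≡⟨ cong (λ s → coeff s m) (*ₚ-constₚ p 1ℚ) ⟩
    coeff (1ℚ ·ₚ p) m                       ≡⟨ coeff-·ₚ 1ℚ p m ⟩
    1ℚ ℚ.* coeff p m                        ∎
    where open ≡-Reasoning
  coeff-*ₚ-sumSq-ones (suc k) p m = begin
    coeff (p *ₚ sumSq (ones k ++ ones k)) m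
      ≡⟨ cong (λ s → coeff (p *ₚ s) m) (sumSq-++ (ones k) (ones k)) ⟩
    coeff (p *ₚ (sumSq (ones k) +ₚ sumSq (ones k))) m
      ≡⟨ coeff-*ₚ-distribˡ p (sumSq (ones k)) (sumSq (ones k)) m ⟩
    coeff (p *ₚ sumSq (ones k)) m ℚ.+ coeff (p *ₚ sumSq (ones k)) m
      ≡⟨ cong₂ ℚ._+_ (coeff-*ₚ-sumSq-ones k p m) (coeff-*ₚ-sumSq-ones k p m) ⟩
    two^ k ℚ.* coeff p m ℚ.+ two^ k ℚ.* coeff p m
      ≡⟨ ℚ.*-distribʳ-+ (coeff p m) (two^ k) (two^ k) ⟨
    (two^ k ℚ.+ two^ k) ℚ.* coeff p m
      ≡⟨ cong (ℚ._* coeff p m) (two^-suc k) ⟨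
    two^ (suc k) ℚ.* coeff p m ∎
    where open ≡-Reasoning

  weightedSum : Poly n
  weightedSum = ΣFin (λ i → two^ (toℕ i) ·ₚ varₚ i)

  coeff-lowerAx-*ₚ-sumSq-ones : ∀ i m →
    coeff (lowerAx i *ₚ sumSq (ones (toℕ i))) m ≡ coeff (two^ (toℕ i) ·ₚ varₚ i) m
  coeff-lowerAx-*ₚ-sumSq-ones i m =
    trans (coeff-*ₚ-sumSq-ones (toℕ i) (varₚ i) m) (sym (coeff-·ₚ (two^ (toℕ i)) (varₚ i) m))

  bvpTerm boolTerms lowerTerms upperTerms : Poly n
  bvpTerm    = constₚ (- 1ℚ) *ₚ bvp n
  boolTerms  = ΣFin (λ i → [] *ₚ boolAx i)
  lowerTerms = ΣFin (λ i → lowerAx i *ₚ sumSq (ones (toℕ i)))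
  upperTerms = ΣFin (λ i → upperAx i *ₚ sumSq [])

  bvpRefutation-identity : (bvpTerm +ₚ boolTerms +ₚ lowerTerms +ₚ upperTerms) ≈ₚ constₚ (- 1ℚ)
  bvpRefutation-identity m = begin
    coeff (bvpTerm +ₚ boolTerms +ₚ lowerTerms +ₚ upperTerms) m
      ≡⟨ coeff-+ₚ-cong (bvpTerm +ₚ boolTerms +ₚ lowerTerms) upperTerms
           (coeff-+ₚ-cong (bvpTerm +ₚ boolTerms) lowerTerms
             (coeff-+ₚ-cong bvpTerm boolTerms bvpTerm≡ boolTerms≡0) lowerTerms≡) upperTerms≡0 ⟩
    - 1ℚ ℚ.* (b ℚ.+ one) ℚ.+ 0ℚ ℚ.+ b ℚ.+ 0ℚ
      ≡⟨ solve 2 (λ b one → con (- 1ℚ) :* (b :+ one) :+ con 0ℚ :+ b :+ con 0ℚ := con (- 1ℚ) :* one) refl b one ⟩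
    - 1ℚ ℚ.* one
      ≡⟨ coeff-·ₚ (- 1ℚ) (constₚ 1ℚ) m ⟨
    coeff (constₚ (- 1ℚ)) m ∎
    where
    open ≡-Reasoning
    open ℚ.+-*-Solver
    b one : ℚ
    b   = coeff weightedSum m
    one = coeff (constₚ 1ℚ) m
    bvpTerm≡ : coeff bvpTerm m ≡ - 1ℚ ℚ.* (b ℚ.+ one)
    bvpTerm≡ = begin
      coeff bvpTerm m                  ≡⟨ cong (λ s → coeff s m) (constₚ-*ₚ (- 1ℚ) (bvp n)) ⟩
      coeff ((- 1ℚ) ·ₚ bvp n) m        ≡⟨ coeff-·ₚ (- 1ℚ) (bvp n) m ⟩
      - 1ℚ ℚ.* coeff (bvp n) m         ≡⟨ cong (- 1ℚ ℚ.*_) (coeff-+ₚ weightedSum (constₚ 1ℚ) m) ⟩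
      - 1ℚ ℚ.* (b ℚ.+ one)             ∎
    boolTerms≡0 : coeff boolTerms m ≡ 0ℚ
    boolTerms≡0 = coeff-Σₚ-zero (λ _ → []) (List.allFin n) m (λ _ → refl)
    lowerTerms≡ : coeff lowerTerms m ≡ b
    lowerTerms≡ = coeff-Σₚ-cong (λ i → lowerAx i *ₚ sumSq (ones (toℕ i))) (λ i → two^ (toℕ i) ·ₚ varₚ i)
                    (List.allFin n) m (λ i → coeff-lowerAx-*ₚ-sumSq-ones i m)
    upperTerms≡0 : coeff upperTerms m ≡ 0ℚ
    upperTerms≡0 = coeff-Σₚ-zero (λ i → upperAx i *ₚ []) (List.allFin n) m
                     (λ i → cong (λ s → coeff s m) (*ₚ-zeroʳ (upperAx i)))

  bvpRefutation : BoolSoSRefutation n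
  bvpRefutation = record
    { pBVP     = constₚ (- 1ℚ)
    ; pBool    = λ _ → []
    ; sLow     = λ i → ones (toℕ i)
    ; sUp      = λ _ → []
    ; identity = bvpRefutation-identity
    }

  monoCount≤1 : ∀ (p : Poly n) w → All (_≡ w) (List.map proj₂ p) → monoCount p ≤ 1
  monoCount≤1 p w ≡w =
    length≤1 (UniqueProperties.deduplicate-! _≟ₘ_ _) (All.deduplicate⁺ _≟ₘ_ (All.filter⁺ _ ≡w))

  sumSq-ones-constant : ∀ k → All (_≡ 0⃗) (List.map proj₂ (sumSq (ones k)))
  sumSq-ones-constant zero = zipWith-identityˡ ℕ.+-identityˡ 0⃗ ∷ []
  sumSq-ones-constant (suc k)
    rewrite sumSq-++ (ones k) (ones k) | List.map-++ proj₂ (sumSq (ones k)) (sumSq (ones k))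
    = All.++⁺ (sumSq-ones-constant k) (sumSq-ones-constant k)

  bvpRefutation-size : BoolSoSRefutation.monomialSize bvpRefutation ≤ suc n
  bvpRefutation-size = begin
    BoolSoSRefutation.monomialSize bvpRefutation
      ≤⟨ ℕ.+-mono-≤ (ℕ.+-mono-≤ (ℕ.+-mono-≤ constant-≤ (ΣFinℕ-≤ {n} _ λ _ → z≤n)) lower-≤)
                    (ΣFinℕ-≤ {n} _ λ _ → z≤n) ⟩
    1 ℕ.+ n * 0 ℕ.+ n * 1 ℕ.+ n * 0
      ≡⟨ solve 1 (λ n → con 1 :+ n :* con 0 :+ n :* con 1 :+ n :* con 0 := con 1 :+ n) refl n ⟩
    suc n ∎
    where
    open ℕ.≤-Reasoning
    open ℕ.+-*-Solver
    constant-≤ : monoCount (constₚ {n} (- 1ℚ)) ≤ 1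
    constant-≤ = monoCount≤1 (constₚ (- 1ℚ)) 0⃗ (refl ∷ [])
    lower-≤ : ΣFinℕ (λ (i : Fin n) → monoCount (sumSq (ones (toℕ i)))) ≤ n * 1
    lower-≤ = ΣFinℕ-≤ {n} _ λ i → monoCount≤1 (sumSq (ones (toℕ i))) 0⃗ (sumSq-ones-constant (toℕ i))

corollary4p5 : ∃ λ (c : ℕ) → ∀ (n : ℕ) → 1 ≤ n →
    Σ (BoolSoSRefutation n) λ R → BoolSoSRefutation.monomialSize R ≤ c * n
corollary4p5 = 2 , λ n 1≤n → bvpRefutation , ℕ.≤-trans bvpRefutation-size (suc≤2* n 1≤n)
  where
  suc≤2* : ∀ n → 1 ≤ n → suc n ≤ 2 * n
  suc≤2* n 1≤n = ℕ.≤-trans (ℕ.+-monoˡ-≤ n 1≤n) (ℕ.≤-reflexive (cong (n ℕ.+_) (sym (ℕ.+-identityʳ n))))
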